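{- Let $G$ be a graph of order $n$ such that both $G$ and its complement $\overline{G}$ are connected. Let $\Delta'=\min\{\Delta(G),\Delta(\overline{G})\}$ and $M=\max\{\mathrm{diam}(G),\mathrm{diam}(\overline{G})\}$, and suppose $M\geq 3$. Then: (i) if $\mathrm{diam}(G)=\mathrm{diam}(\overline{G})=3$, then $\rho(G)+\rho(\overline{G})=\rho(G)\rho(\overline{G})=4$; (ii) if $\mathrm{diam}(G)\neq\mathrm{diam}(\overline{G})$, then $$\rho(G)+\rho(\overline{G})\leq n-\left\lceil\frac{2M+3\Delta'-11}{3}\right\rceil\quad\text{and}\quad\rho(G)\rho(\overline{G})\leq n-\left\lceil\frac{2M+3\Delta'-8}{3}\right\rceil.$$ Furthermore, the bounds in (ii) are sharp, i.e. each is attained with equality by some graph $G$ satisfying the hypotheses.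
   Context: All graphs are finite and simple. $\Delta(G)$ is the maximum degree and $\mathrm{diam}(G)$ the diameter of $G$. For a vertex $v$, $N[v]$ is its closed neighborhood. A set $B\subseteq V(G)$ is a packing ($2$-packing) if $N[u]\cap N[v]=\emptyset$ for all distinct $u,v\in B$; $\rho(G)$ denotes the maximum size of a packing in $G$. -}

module Defs where

open import Data.Nat as ℕ using (ℕ; zero; suc; _≤_; _<_; _⊔_)
open import Data.Integer as ℤ using (ℤ; _/ℕ_)
open import Data.Bool using (Bool; true; false; not; _∧_; if_then_else_)
open import Data.Fin using (Fin; _≟_)
open import Data.Fin.Subset using (Subset; _∈_)
open import Data.List using (List; foldr; map; allFin)
open import Data.Product using (Σ; ∃; _×_; _,_)
open import Data.Sum using (_⊎_)
open import Relation.Nullary using (¬_; yes; no)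
open import Relation.Nullary.Decidable using (⌊_⌋)
open import Relation.Binary.PropositionalEquality using (_≡_; _≢_; refl; sym)

record Graph (n : ℕ) : Set where
  field
    adj    : Fin n → Fin n → Bool
    adj-sym    : ∀ i j → adj i j ≡ adj j i
    adj-irrefl : ∀ i → adj i i ≡ false
open Graph public

private
  eqb : ∀ {n} → Fin n → Fin n → Bool
  eqb i j = ⌊ i ≟ j ⌋

  eqb-sym : ∀ {n} (i j : Fin n) → eqb i j ≡ eqb j i
  eqb-sym i j with i ≟ j | j ≟ i
  ... | yes _ | yes _ = refl
  ... | no _  | no _  = refl
  ... | yes p | no q  with q (sym p)
  ... | ()
  eqb-sym i j | no q | yes p with q (sym p)
  ... | ()

  eqb-refl : ∀ {n} (i : Fin n) → eqb i i ≡ true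
  eqb-refl i with i ≟ i
  ... | yes _ = refl
  ... | no q with q refl
  ... | ()

  ∧-false : ∀ b → b ∧ false ≡ false
  ∧-false true  = refl
  ∧-false false = refl

  compl-sym : ∀ {n} (G : Graph n) (i j : Fin n) →
    not (adj G i j) ∧ not (eqb i j) ≡ not (adj G j i) ∧ not (eqb j i)
  compl-sym G i j rewrite adj-sym G i j | eqb-sym i j = refl

  compl-irrefl : ∀ {n} (G : Graph n) (i : Fin n) →
    not (adj G i i) ∧ not (eqb i i) ≡ false
  compl-irrefl G i rewrite eqb-refl i = ∧-false (not (adj G i i))

complement : ∀ {n} → Graph n → Graph n
complement G = record
  { adj        = λ i j → not (adj G i j) ∧ not (eqb i j)
  ; adj-sym    = compl-sym G
  ; adj-irrefl = compl-irrefl G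
  }

-- Degree of a vertex and maximum degree Δ(G) (Δ = 0 for the empty graph).
countTrue : List Bool → ℕ
countTrue = foldr (λ b k → if b then suc k else k) 0

deg : ∀ {n} → Graph n → Fin n → ℕ
deg {n} G v = countTrue (map (adj G v) (allFin n))

maxDeg : ∀ {n} → Graph n → ℕ
maxDeg {n} G = foldr _⊔_ 0 (map (deg G) (allFin n))

data Walk {n : ℕ} (G : Graph n) : Fin n → Fin n → ℕ → Set where
  here : ∀ {u} → Walk G u u 0
  step : ∀ {u w v k} → adj G u w ≡ true → Walk G w v k → Walk G u v (suc k)

Dist : ∀ {n} → Graph n → Fin n → Fin n → ℕ → Set
Dist G u v d = Walk G u v d × (∀ k → k < d → ¬ Walk G u v k)

Connected : ∀ {n} → Graph n → Set
Connected G = ∀ u v → ∃ λ k → Walk G u v k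

IsDiam : ∀ {n} → Graph n → ℕ → Set
IsDiam G d =
  (∀ u v → ∃ λ k → Dist G u v k × k ≤ d) × (∃ λ u → ∃ λ v → Dist G u v d)

InN : ∀ {n} → Graph n → Fin n → Fin n → Set
InN G u w = (w ≡ u) ⊎ (adj G u w ≡ true)

IsPacking : ∀ {n} → Graph n → Subset n → Set
IsPacking G B = ∀ u v → u ∈ B → v ∈ B → u ≢ v → ∀ w → ¬ (InN G u w × InN G v w)

IsPackingNumber : ∀ {n} → Graph n → ℕ → Set
IsPackingNumber G r =
  (∃ λ B → IsPacking G B × Data.Fin.Subset.∣ B ∣ ≡ r)
  × (∀ B → IsPacking G B → Data.Fin.Subset.∣ B ∣ ≤ r)

-- ⌈ x / 3 ⌉ for integers x  (/ℕ is floor division for a positive divisor).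
ceil3 : ℤ → ℤ
ceil3 x = ℤ.- ((ℤ.- x) /ℕ 3)

bound : ℕ → ℕ → ℕ → ℕ → ℤ
bound n M Δ' c = ℤ.+ n ℤ.- ceil3 (ℤ.+ (2 ℕ.* M ℕ.+ 3 ℕ.* Δ') ℤ.- ℤ.+ c)

Hyp : (n : ℕ) → Graph n → ℕ → ℕ → ℕ → ℕ → Set
Hyp n G dG dGc r rc =
  Connected G × Connected (complement G)
  × IsDiam G dG × IsDiam (complement G) dGc
  × IsPackingNumber G r × IsPackingNumber (complement G) rc
  × 3 ≤ dG ⊔ dGc

-- Two facts carry the proof.
-- (1) Complement principle.  Call K "all-common" if every two vertices have a common
--     closed neighbour (diam K ≤ 2); then ρ(K) ≤ 1.  If H has two vertices at distance
--     ≥ 4, its complement K is all-common; so is K when diam K < diam H ≤ 3; and so is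
--     K when H has a packing with three members.  With the two ends of a diametral
--     path (a packing of size 2) this gives ρ(G) = ρ(Ḡ) = 2 in part (i).
-- (2) Counting bound.  For a geodesic of length M in H, a packing B and a vertex x,
--     2M + 3(deg x + |B|) ≤ 3n + 8: along the geodesic N[x] occupies at most three
--     consecutive positions and members of B are at least three apart, so at least
--     (2M − 8)/3 geodesic vertices lie outside N[x] ∪ B.
-- Part (ii) applies (2) to the graph of larger diameter and (1) to the other one, and
-- restates the result with integer ceilings.  Sharpness is witnessed by a spider on
-- six vertices, verified by decision procedures.

module Submission where

open import Defs
open import Function using (_∘_; id)
open import Data.Nat using (ℕ; zero; suc; _+_; _*_; _∸_; _≤_; _<_; _⊔_; _⊓_; z≤n; s≤s; _≤?_)
open import Data.Nat.Properties hiding (_≟_; suc-injective)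
import Data.Nat.Solver
module ℕS = Data.Nat.Solver.+-*-Solver
import Data.Integer as ℤ
import Data.Integer.Properties as ℤP
open import Data.Integer.DivMod using (n<s[n/ℕd]*d)
import Data.Integer.Solver
module ℤS = Data.Integer.Solver.+-*-Solver
open import Algebra.Properties.CommutativeSemigroup +-commutativeSemigroup
  using (interchange; x∙yz≈y∙xz)
open import Data.Bool as Bool using (Bool; true; false; not; _∧_; _∨_)
open import Data.Bool.Properties using (∨-comm; ∧-comm; ∧-identityʳ; ∧-zeroʳ; not-injective)
open import Data.Fin using (Fin; zero; suc; toℕ; #_)
open import Data.Fin.Properties using (_≟_; suc-injective; all?; any?)
open import Data.Fin.Subset using (Subset; _∈_; ∣_∣; ⁅_⁆; _∪_)
open import Data.Fin.Subset.Properties using (_∈?_; x∈⁅x⁆; x∈⁅y⁆⇒x≡y; x∈p∪q⁺; x∈p∪q⁻)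
open import Data.Vec using ([]; _∷_; lookup)
open import Data.Vec.Properties using (lookup⇒[]=; []=⇒lookup)
import Data.List as List
open import Data.List.Properties using (map-tabulate)
open import Data.Product using (∃; _×_; _,_; proj₁; proj₂)
open import Data.Sum using (_⊎_; inj₁; inj₂; [_,_])
open import Data.Empty using (⊥; ⊥-elim)
open import Relation.Binary using (tri<; tri≈; tri>)
open import Relation.Nullary using (¬_; Dec; yes; no; does)
open import Relation.Nullary.Decidable using (dec-true; map′; from-yes; ¬?; _×-dec_; _→-dec_)
open import Relation.Binary.PropositionalEquality hiding ([_])

⟦_⟧ : Bool → ℕ
⟦ true ⟧ = 1
⟦ false ⟧ = 0

count : ∀ {n} → (Fin n → Bool) → ℕ
count {zero} f = 0
count {suc n} f = ⟦ f zero ⟧ + count (f ∘ suc)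

_==_ : ∀ {n} → Fin n → Fin n → Bool
i == j = does (i ≟ j)

count-cong : ∀ {n} {f g : Fin n → Bool} → (∀ i → f i ≡ g i) → count f ≡ count g
count-cong {zero} _ = refl
count-cong {suc n} f≗g = cong₂ _+_ (cong ⟦_⟧ (f≗g zero)) (count-cong (f≗g ∘ suc))

count-all : ∀ n → count {n} (λ _ → true) ≡ n
count-all zero = refl
count-all (suc n) = cong suc (count-all n)

count-none : ∀ n → count {n} (λ _ → false) ≡ 0
count-none zero = refl
count-none (suc n) = count-none n

count-split : ∀ {n} (f g : Fin n → Bool) →
  count f ≡ count (λ i → f i ∧ g i) + count (λ i → f i ∧ not (g i))
count-split {zero} f g = refl
count-split {suc n} f g = trans
  (cong₂ _+_ (split-one (f zero) (g zero)) (count-split (f ∘ suc) (g ∘ suc)))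
  (interchange ⟦ f zero ∧ g zero ⟧ ⟦ f zero ∧ not (g zero) ⟧ _ _)
  where
  split-one : ∀ a b → ⟦ a ⟧ ≡ ⟦ a ∧ b ⟧ + ⟦ a ∧ not b ⟧
  split-one false _ = refl
  split-one true false = refl
  split-one true true = refl

count-remove : ∀ {n} (f : Fin n → Bool) (a : Fin n) →
  count f ≡ ⟦ f a ⟧ + count (λ i → f i ∧ not (i == a))
count-remove {suc n} f zero rewrite ∧-zeroʳ (f zero) =
  cong (⟦ f zero ⟧ +_) (count-cong (λ i → sym (∧-identityʳ (f (suc i)))))
count-remove {suc n} f (suc a) rewrite ∧-identityʳ (f zero) =
  trans (cong (⟦ f zero ⟧ +_) (count-remove (f ∘ suc) a))
        (x∙yz≈y∙xz ⟦ f zero ⟧ ⟦ f (suc a) ⟧ _)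

count-nonzero : ∀ {n} (f : Fin n → Bool) → 1 ≤ count f → ∃ λ i → f i ≡ true
count-nonzero {suc n} f pos with f zero in f0
... | true = zero , f0
... | false with count-nonzero (f ∘ suc) pos
... | i , fi = suc i , fi

count-≤1 : ∀ {n} (f : Fin n → Bool) → (∀ i j → f i ≡ true → f j ≡ true → i ≡ j) → count f ≤ 1
count-≤1 {zero} f _ = z≤n
count-≤1 {suc n} f unique with f zero in f0
... | true = ≤-reflexive (cong suc (trans (count-cong rest-empty) (count-none n)))
  where
  rest-empty : ∀ i → f (suc i) ≡ false
  rest-empty i with f (suc i) in fi
  ... | false = refl
  ... | true with unique zero (suc i) f0 fi
  ... | ()
... | false = count-≤1 (f ∘ suc) (λ i j fi fj → suc-injective (unique (suc i) (suc j) fi fj))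

count-≥2 : ∀ {n} (f : Fin n → Bool) {a b : Fin n} → f a ≡ true → f b ≡ true → a ≢ b → 2 ≤ count f
count-≥2 {n} f {a} {b} fa fb a≢b = begin
  2                                          ≡⟨ cong₂ (λ x y → ⟦ x ⟧ + ⟦ y ⟧) (sym fa) (sym fb′) ⟩
  ⟦ f a ⟧ + ⟦ f′ b ⟧                         ≤⟨ +-monoʳ-≤ ⟦ f a ⟧ (one≤count f′ b) ⟩
  ⟦ f a ⟧ + count f′                         ≡⟨ sym (count-remove f a) ⟩
  count f                                    ∎
  where
  open ≤-Reasoning
  f′ : Fin n → Bool
  f′ i = f i ∧ not (i == a)
  fb′ : f′ b ≡ true
  fb′ with b ≟ a
  ... | yes b≡a = ⊥-elim (a≢b (sym b≡a))
  ... | no _ = trans (∧-identityʳ (f b)) fb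
  one≤count : ∀ {m} (g : Fin m → Bool) c → ⟦ g c ⟧ ≤ count g
  one≤count g c = subst (⟦ g c ⟧ ≤_) (sym (count-remove g c)) (m≤m+n _ _)

deg≡count : ∀ {n} (G : Graph n) v → deg G v ≡ count (adj G v)
deg≡count {n} G v =
  trans (cong countTrue (map-tabulate id (adj G v))) (countTrue-tabulate (adj G v))
  where
  countTrue-tabulate : ∀ {m} (f : Fin m → Bool) → countTrue (List.tabulate f) ≡ count f
  countTrue-tabulate {zero} f = refl
  countTrue-tabulate {suc m} f with f zero
  ... | true = cong suc (countTrue-tabulate (f ∘ suc))
  ... | false = countTrue-tabulate (f ∘ suc)

∣∣≡count : ∀ {n} (B : Subset n) → ∣ B ∣ ≡ count (lookup B)
∣∣≡count [] = refl
∣∣≡count (true ∷ B) = cong suc (∣∣≡count B)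
∣∣≡count (false ∷ B) = ∣∣≡count B

maxDeg-attained : ∀ {n} (G : Graph n) → maxDeg G ≡ 0 ⊎ ∃ λ x → maxDeg G ≡ deg G x
maxDeg-attained {n} G rewrite map-tabulate id (deg G) = max-attained (deg G)
  where
  max-attained : ∀ {m} (f : Fin m → ℕ) →
    List.foldr _⊔_ 0 (List.tabulate f) ≡ 0 ⊎ ∃ λ i → List.foldr _⊔_ 0 (List.tabulate f) ≡ f i
  max-attained {zero} f = inj₁ refl
  max-attained {suc m} f with ⊔-sel (f zero) (List.foldr _⊔_ 0 (List.tabulate (f ∘ suc)))
  ... | inj₁ e = inj₂ (zero , e)
  ... | inj₂ e with max-attained (f ∘ suc)
  ... | inj₁ e′ = inj₁ (trans e e′)
  ... | inj₂ (i , e′) = inj₂ (suc i , trans e e′)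

∧-true : ∀ {a b} → a ∧ b ≡ true → a ≡ true × b ≡ true
∧-true {true} {true} _ = refl , refl

holds : ∀ {A : Set} (a? : Dec A) → does a? ≡ true → A
holds (yes a) _ = a

fails : ∀ {A : Set} (a? : Dec A) → does a? ≡ false → ¬ A
fails (no ¬a) _ = ¬a

inN? : ∀ {n} (G : Graph n) a w → Dec (InN G a w)
inN? G a w with w ≟ a | adj G a w
... | yes w≡a | _ = yes (inj₁ w≡a)
... | no w≢a | true = yes (inj₂ refl)
... | no w≢a | false = no λ { (inj₁ w≡a) → w≢a w≡a ; (inj₂ ()) }

InN-sym : ∀ {n} {G : Graph n} {a b} → InN G a b → InN G b a
InN-sym (inj₁ b≡a) = inj₁ (sym b≡a)
InN-sym {G = G} {a} {b} (inj₂ e) = inj₂ (trans (adj-sym G b a) e)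

Common : ∀ {n} → Graph n → Fin n → Fin n → Set
Common K x y = ∃ λ t → InN K x t × InN K y t

-- Every two vertices of K have a common closed neighbour, i.e. diam K ≤ 2.
AllCommon : ∀ {n} → Graph n → Set
AllCommon K = ∀ x y → Common K x y

-- K contains every non-edge of H.  Both (G, Ḡ) and (Ḡ, G) are such pairs,
-- which lets every statement about "a graph and its complement" be proved once.
record Covers {n} (H K : Graph n) : Set where
  field
    non-edge⇒edge : ∀ x y → x ≢ y → adj H x y ≡ false → adj K x y ≡ true
open Covers

complement-covers : ∀ {n} (G : Graph n) → Covers G (complement G)
non-edge⇒edge (complement-covers G) x y x≢y nonadj with x ≟ y
... | yes x≡y = ⊥-elim (x≢y x≡y)
... | no _ rewrite nonadj = refl

complement-covered : ∀ {n} (G : Graph n) → Covers (complement G) G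
non-edge⇒edge (complement-covered G) x y x≢y nonadj with adj G x y | x ≟ y
... | _ | yes x≡y = ⊥-elim (x≢y x≡y)
... | true | no _ = refl
... | false | no _ with nonadj
... | ()

outside-covered : ∀ {n} {H K : Graph n} → Covers H K → ∀ {t z} → ¬ InN H t z → InN K z t
outside-covered {H = H} cov {t} {z} z∉N[t] with adj H t z in e
... | true = ⊥-elim (z∉N[t] (inj₂ refl))
... | false = inj₂ (non-edge⇒edge cov z t (λ z≡t → z∉N[t] (inj₁ z≡t)) (trans (adj-sym H z t) e))

-- Walks and geodesics.

module _ {n : ℕ} {G : Graph n} where

  infixr 5 _++w_
  _++w_ : ∀ {a b c k l} → Walk G a b k → Walk G b c l → Walk G a c (k + l)
  here ++w q = q
  step e p ++w q = step e (p ++w q)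

  reverse : ∀ {a b k} → Walk G a b k → Walk G b a k
  reverse here = here
  reverse (step {u} {w} {_} {k} e p) =
    subst (Walk G _ _) (+-comm k 1) (reverse p ++w step (trans (adj-sym G w u) e) here)

  InN⇒walk : ∀ {a t} → InN G a t → ∃ λ L → L ≤ 1 × Walk G a t L
  InN⇒walk (inj₁ refl) = 0 , z≤n , here
  InN⇒walk (inj₂ e) = 1 , ≤-refl , step e here

  common⇒walk : ∀ {x y} → Common G x y → ∃ λ L → L ≤ 2 × Walk G x y L
  common⇒walk (t , xt , yt) with InN⇒walk xt | InN⇒walk yt
  ... | L₁ , L₁≤1 , p | L₂ , L₂≤1 , q = L₁ + L₂ , +-mono-≤ L₁≤1 L₂≤1 , p ++w reverse q

  walk⇒common : ∀ {x y} k → k ≤ 2 → Walk G x y k → Common G x y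
  walk⇒common {x} zero _ here = x , inj₁ refl , inj₁ refl
  walk⇒common {y = y} 1 _ (step e here) = y , inj₂ e , inj₁ refl
  walk⇒common 2 _ (step {w = w} e (step e′ here)) = w , inj₂ e , inj₂ (trans (adj-sym G _ _) e′)
  walk⇒common (suc (suc (suc _))) (s≤s (s≤s ())) _

  vertex : ∀ {a b k} → Walk G a b k → ℕ → Fin n
  vertex {a} here _ = a
  vertex {a} (step _ _) zero = a
  vertex (step _ p) (suc i) = vertex p i

  prefix : ∀ {a b k} (p : Walk G a b k) i → i ≤ k → Walk G a (vertex p i) i
  prefix here zero _ = here
  prefix (step _ _) zero _ = here
  prefix (step e p) (suc i) (s≤s i≤k) = step e (prefix p i i≤k)

  suffix : ∀ {a b k} (p : Walk G a b k) i → i ≤ k → Walk G (vertex p i) b (k ∸ i)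
  suffix here zero _ = here
  suffix (step e p) zero _ = step e p
  suffix (step _ p) (suc i) (s≤s i≤k) = suffix p i i≤k

  vertex-adj : ∀ {a b k} (p : Walk G a b k) i → i < k → adj G (vertex p i) (vertex p (suc i)) ≡ true
  vertex-adj (step e here) zero _ = e
  vertex-adj (step e (step _ _)) zero _ = e
  vertex-adj (step _ p) (suc i) (s≤s i<k) = vertex-adj p i i<k

  module Geodesic {u v : Fin n} {M : ℕ} (geo : Dist G u v M) where

    v[_] : ℕ → Fin n
    v[_] = vertex (proj₁ geo)

    shortcut : ∀ {i j L} → i ≤ j → j ≤ M → Walk G v[ i ] v[ j ] L → j ≤ i + L
    shortcut {i} {j} {L} i≤j j≤M p = +-cancelʳ-≤ (M ∸ j) j (i + L) (begin
      j + (M ∸ j)         ≡⟨ m+[n∸m]≡n j≤M ⟩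
      M                   ≤⟨ long ⟩
      i + (L + (M ∸ j))   ≡⟨ +-assoc i L (M ∸ j) ⟨
      i + L + (M ∸ j)     ∎)
      where
      open ≤-Reasoning
      long : M ≤ i + (L + (M ∸ j))
      long with M ≤? i + (L + (M ∸ j))
      ... | yes ok = ok
      ... | no too-short = ⊥-elim (proj₂ geo _ (≰⇒> too-short)
              (prefix (proj₁ geo) i (≤-trans i≤j j≤M) ++w p ++w suffix (proj₁ geo) j j≤M))

    consecutive : ∀ i → i < M → adj G v[ i ] v[ suc i ] ≡ true
    consecutive = vertex-adj (proj₁ geo)

    injective : ∀ {i j} → i < j → j ≤ M → v[ i ] ≢ v[ j ]
    injective {i} i<j j≤M vi≡vj = <⇒≱ i<j (begin
      _      ≤⟨ shortcut (<⇒≤ i<j) j≤M (subst (λ z → Walk G v[ i ] z 0) vi≡vj here) ⟩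
      i + 0  ≡⟨ +-identityʳ i ⟩
      i      ∎)
      where open ≤-Reasoning

    nbhd-window : ∀ {x i j} → InN G x v[ i ] → InN G x v[ j ] → i ≤ j → j ≤ M → j ≤ 2 + i
    nbhd-window {i = i} xi xj i≤j j≤M with common⇒walk (_ , InN-sym {G = G} xi , InN-sym {G = G} xj)
    ... | L , L≤2 , p = ≤-trans (shortcut i≤j j≤M p) (≤-trans (+-monoʳ-≤ i L≤2) (≤-reflexive (+-comm i 2)))

-- All-common graphs and packings.

far-apart : ∀ {n} {H : Graph n} {u v d} → Dist H u v d → 3 ≤ d → ¬ Common H u v
far-apart (_ , minimal) 3≤d c with common⇒walk c
... | L , L≤2 , p = minimal L (≤-trans (s≤s L≤2) 3≤d) p

diam≤2⇒AllCommon : ∀ {n} {K : Graph n} {d} → IsDiam K d → d ≤ 2 → AllCommon K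
diam≤2⇒AllCommon (reach , _) d≤2 x y with reach x y
... | k , (p , _) , k≤d = walk⇒common k (≤-trans k≤d d≤2) p

sees-or-common : ∀ {n} {H K : Graph n} → Covers H K → ∀ w x y →
  (InN H w x ⊎ InN H w y) ⊎ Common K x y
sees-or-common {H = H} cov w x y with inN? H w x | inN? H w y
... | yes wx | _ = inj₁ (inj₁ wx)
... | no _ | yes wy = inj₁ (inj₂ wy)
... | no w∤x | no w∤y = inj₂ (w , outside-covered cov w∤x , outside-covered cov w∤y)

detour : ∀ {n} {H : Graph n} {u v a b k} → InN H u a → Walk H a b k → k ≤ 1 → InN H v b →
  ∃ λ L → L ≤ 3 × Walk H u v L
detour ua p k≤1 vb with InN⇒walk ua | InN⇒walk vb
... | L₁ , L₁≤1 , p₁ | L₂ , L₂≤1 , p₂ =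
  L₁ + (_ + L₂) , +-mono-≤ L₁≤1 (+-mono-≤ k≤1 L₂≤1) , p₁ ++w p ++w reverse p₂

far⇒AllCommon : ∀ {n} {H K : Graph n} → Covers H K → ∀ {u v} →
  (∀ k → k ≤ 3 → ¬ Walk H u v k) → AllCommon K
far⇒AllCommon {H = H} cov {u} {v} far x y with x ≟ y
... | yes refl = x , inj₁ refl , inj₁ refl
... | no x≢y with adj H x y in xy
...   | false = y , inj₂ (non-edge⇒edge cov x y x≢y xy) , inj₁ refl
...   | true with sees-or-common cov u x y | sees-or-common cov v x y
...     | inj₂ c | _ = c
...     | inj₁ _ | inj₂ c = c
...     | inj₁ u-sees | inj₁ v-sees = ⊥-elim (too-close (join u-sees v-sees))
  where
  x→y : Walk H x y 1
  x→y = step xy here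
  join : (InN H u x ⊎ InN H u y) → (InN H v x ⊎ InN H v y) → ∃ λ L → L ≤ 3 × Walk H u v L
  join (inj₁ ux) (inj₁ vx) = detour ux here z≤n vx
  join (inj₁ ux) (inj₂ vy) = detour ux x→y ≤-refl vy
  join (inj₂ uy) (inj₁ vx) = detour uy (reverse x→y) ≤-refl vx
  join (inj₂ uy) (inj₂ vy) = detour uy here z≤n vy
  too-close : (∃ λ L → L ≤ 3 × Walk H u v L) → ⊥
  too-close (L , L≤3 , p) = far L L≤3 p

packing-unique : ∀ {n} (H : Graph n) {B} → IsPacking H B →
  ∀ {b b′ w} → b ∈ B → b′ ∈ B → InN H b w → InN H b′ w → b ≡ b′
packing-unique H P {b} {b′} {w} b∈B b′∈B bw b′w with b ≟ b′
... | yes b≡b′ = b≡b′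
... | no b≢b′ = ⊥-elim (P b b′ b∈B b′∈B b≢b′ w (bw , b′w))

near-≤1 : ∀ {n} (H : Graph n) {B} → IsPacking H B → ∀ w (f : Fin n → Bool) →
  (∀ b → f b ≡ true → b ∈ B × InN H b w) → count f ≤ 1
near-≤1 H P w f near = count-≤1 f λ i j fi fj →
  packing-unique H P (proj₁ (near i fi)) (proj₁ (near j fj)) (proj₂ (near i fi)) (proj₂ (near j fj))

AllCommon⇒packing≤1 : ∀ {n} (K : Graph n) → AllCommon K → ∀ {B} → IsPacking K B → ∣ B ∣ ≤ 1
AllCommon⇒packing≤1 K common {B} P = subst (_≤ 1) (sym (∣∣≡count B)) (count-≤1 (lookup B) same)
  where
  same : ∀ i j → lookup B i ≡ true → lookup B j ≡ true → i ≡ j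
  same i j Bi Bj = packing-unique K P (lookup⇒[]= i B Bi) (lookup⇒[]= j B Bj)
                     (proj₁ (proj₂ (common i j))) (proj₂ (proj₂ (common i j)))

-- A packing of H with three members forces all pairs to have a common neighbour in K:
-- at most two members see x or y, so a third is K-adjacent to both.
packing≥3⇒AllCommon : ∀ {n} {H K : Graph n} → Covers H K → ∀ {B} → IsPacking H B →
  3 ≤ ∣ B ∣ → AllCommon K
packing≥3⇒AllCommon {n} {H} cov {B} P 3≤∣B∣ x y
  with count-nonzero unseen (≤-pred (≤-pred (≤-trans 3≤∣B∣ ∣B∣≤2+unseen)))
  where
  inB sees-x sees-y seeing-x not-seeing-x seeing-y unseen : Fin n → Bool
  inB = lookup B
  sees-x b = does (inN? H b x)
  sees-y b = does (inN? H b y)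
  seeing-x b = inB b ∧ sees-x b
  not-seeing-x b = inB b ∧ not (sees-x b)
  seeing-y b = not-seeing-x b ∧ sees-y b
  unseen b = not-seeing-x b ∧ not (sees-y b)
  ∣B∣≤2+unseen : ∣ B ∣ ≤ 2 + count unseen
  ∣B∣≤2+unseen = begin
    ∣ B ∣                 ≡⟨ ∣∣≡count B ⟩
    count inB             ≡⟨ count-split inB sees-x ⟩
    count seeing-x + count not-seeing-x
      ≡⟨ cong (count seeing-x +_) (count-split not-seeing-x sees-y) ⟩
    count seeing-x + (count seeing-y + count unseen)
      ≤⟨ +-mono-≤ (near-≤1 H P x seeing-x member-seeing-x)
                  (+-monoˡ-≤ (count unseen) (near-≤1 H P y seeing-y member-seeing-y)) ⟩
    2 + count unseen      ∎
    where
    open ≤-Reasoning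
    member-seeing-x : ∀ b → seeing-x b ≡ true → b ∈ B × InN H b x
    member-seeing-x b e = lookup⇒[]= b B (proj₁ (∧-true e)) , holds (inN? H b x) (proj₂ (∧-true e))
    member-seeing-y : ∀ b → seeing-y b ≡ true → b ∈ B × InN H b y
    member-seeing-y b e = lookup⇒[]= b B (proj₁ (∧-true (proj₁ (∧-true e)))) ,
                          holds (inN? H b y) (proj₂ (∧-true e))
... | b , unseen-b = b , outside-covered cov (fails (inN? H b x) (not-injective b∤x)) ,
                         outside-covered cov (fails (inN? H b y) (not-injective b∤y))
  where
  b∤x : not (does (inN? H b x)) ≡ true
  b∤x = proj₂ (∧-true {lookup B b} (proj₁ (∧-true {lookup B b ∧ not (does (inN? H b x))} unseen-b)))
  b∤y : not (does (inN? H b y)) ≡ true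
  b∤y = proj₂ (∧-true {lookup B b ∧ not (does (inN? H b x))} unseen-b)

dist-distinct : ∀ {n} {H : Graph n} {u v d} → Dist H u v (suc d) → u ≢ v
dist-distinct (_ , minimal) refl = minimal 0 (s≤s z≤n) here

∈-pair : ∀ {n} {u v x : Fin n} → x ∈ ⁅ u ⁆ ∪ ⁅ v ⁆ → x ≡ u ⊎ x ≡ v
∈-pair {u = u} {v} x∈ with x∈p∪q⁻ ⁅ u ⁆ ⁅ v ⁆ x∈
... | inj₁ x∈u = inj₁ (x∈⁅y⁆⇒x≡y u x∈u)
... | inj₂ x∈v = inj₂ (x∈⁅y⁆⇒x≡y v x∈v)

pair-size : ∀ {n} {u v : Fin n} → u ≢ v → 2 ≤ ∣ ⁅ u ⁆ ∪ ⁅ v ⁆ ∣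
pair-size {u = u} {v} u≢v = subst (2 ≤_) (sym (∣∣≡count (⁅ u ⁆ ∪ ⁅ v ⁆)))
  (count-≥2 (lookup (⁅ u ⁆ ∪ ⁅ v ⁆))
    ([]=⇒lookup (x∈p∪q⁺ {p = ⁅ u ⁆} (inj₁ (x∈⁅x⁆ u))))
    ([]=⇒lookup (x∈p∪q⁺ {p = ⁅ u ⁆} (inj₂ (x∈⁅x⁆ v)))) u≢v)

antipodal-packing : ∀ {n} {H : Graph n} {u v d} → Dist H u v d → 3 ≤ d → IsPacking H (⁅ u ⁆ ∪ ⁅ v ⁆)
antipodal-packing geo 3≤d a b a∈ b∈ a≢b w (aw , bw) with ∈-pair a∈ | ∈-pair b∈
... | inj₁ refl | inj₁ refl = a≢b refl
... | inj₂ refl | inj₂ refl = a≢b refl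
... | inj₁ refl | inj₂ refl = far-apart geo 3≤d (w , aw , bw)
... | inj₂ refl | inj₁ refl = far-apart geo 3≤d (w , bw , aw)

-- If H and K ⊇ H̄ both have diameter 3, then ρ(H) = 2: the ends of a diametral path
-- give a packing of size 2, and a packing of size 3 would force diam K ≤ 2.
ρ≡2 : ∀ {n} {H K : Graph n} {r} → Covers H K → IsDiam H 3 → IsDiam K 3 → IsPackingNumber H r → r ≡ 2
ρ≡2 cov (_ , u , v , geoH) (_ , x , y , geoK) ((B , P , refl) , maximal) = ≤-antisym upper lower
  where
  lower : 2 ≤ ∣ B ∣
  lower = ≤-trans (pair-size (dist-distinct geoH)) (maximal _ (antipodal-packing geoH ≤-refl))
  upper : ∣ B ∣ ≤ 2
  upper with 3 ≤? ∣ B ∣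
  ... | yes 3≤∣B∣ = ⊥-elim (far-apart geoK ≤-refl (packing≥3⇒AllCommon cov P 3≤∣B∣ x y))
  ... | no 3≰∣B∣ = ≤-pred (≰⇒> 3≰∣B∣)

-- Sums over ranges of ℕ, and labelled paths.

sumFrom : (ℕ → ℕ) → ℕ → ℕ → ℕ
sumFrom f a zero = 0
sumFrom f a (suc k) = f a + sumFrom f (suc a) k

sumFrom-split : ∀ f a k l → sumFrom f a (k + l) ≡ sumFrom f a k + sumFrom f (a + k) l
sumFrom-split f a zero l rewrite +-identityʳ a = refl
sumFrom-split f a (suc k) l rewrite sumFrom-split f (suc a) k l | +-suc a k =
  sym (+-assoc (f a) _ _)

sumFrom-≤-prefix : ∀ f a k l → sumFrom f a k ≤ sumFrom f a (k + l)
sumFrom-≤-prefix f a k l = subst (sumFrom f a k ≤_) (sym (sumFrom-split f a k l)) (m≤m+n _ _)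

AllIn : (ℕ → Set) → ℕ → ℕ → Set
AllIn P a k = ∀ i → a ≤ i → i < a + k → P i

allIn-head : ∀ {P a k} → AllIn P a (suc k) → P a
allIn-head {a = a} all = all a ≤-refl (m<m+n a (s≤s z≤n))

allIn-tail : ∀ {P a k} → AllIn P a (suc k) → AllIn P (suc a) k
allIn-tail {a = a} {k} all i a<i i<end = all i (<⇒≤ a<i) (subst (i <_) (sym (+-suc a k)) i<end)

sumFrom-cong : ∀ {f g} a k → AllIn (λ i → f i ≡ g i) a k → sumFrom f a k ≡ sumFrom g a k
sumFrom-cong a zero _ = refl
sumFrom-cong a (suc k) f≗g = cong₂ _+_ (allIn-head f≗g) (sumFrom-cong (suc a) k (allIn-tail f≗g))

injective-sum : ∀ {n} (g : ℕ → Fin n) K → (∀ i j → i < j → j < K → g i ≢ g j) →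
  (f : Fin n → Bool) → sumFrom (⟦_⟧ ∘ f ∘ g) 0 K ≤ count f
injective-sum g zero _ f = z≤n
injective-sum {n} g (suc K) g-inj f = begin
  sumFrom (⟦_⟧ ∘ f ∘ g) 0 (suc K)          ≡⟨ cong (sumFrom (⟦_⟧ ∘ f ∘ g) 0) (+-comm 1 K) ⟩
  sumFrom (⟦_⟧ ∘ f ∘ g) 0 (K + 1)           ≡⟨ sumFrom-split (⟦_⟧ ∘ f ∘ g) 0 K 1 ⟩
  sumFrom (⟦_⟧ ∘ f ∘ g) 0 K + (⟦ f (g K) ⟧ + 0) ≡⟨ cong₂ _+_ (sumFrom-cong 0 K same-below) (+-identityʳ _) ⟩
  sumFrom (⟦_⟧ ∘ f′ ∘ g) 0 K + ⟦ f (g K) ⟧   ≤⟨ +-monoˡ-≤ _ (injective-sum g K (λ i j i<j j<K → g-inj i j i<j (m≤n⇒m≤1+n j<K)) f′) ⟩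
  count f′ + ⟦ f (g K) ⟧                      ≡⟨ +-comm (count f′) _ ⟩
  ⟦ f (g K) ⟧ + count f′                      ≡⟨ count-remove f (g K) ⟨
  count f                                     ∎
  where
  open ≤-Reasoning
  f′ : Fin n → Bool
  f′ w = f w ∧ not (w == g K)
  same-below : AllIn (λ i → ⟦ f (g i) ⟧ ≡ ⟦ f′ (g i) ⟧) 0 K
  same-below i _ i<K with g i ≟ g K
  ... | yes gi≡gK = ⊥-elim (g-inj i K i<K ≤-refl gi≡gK)
  ... | no _ = cong ⟦_⟧ (sym (∧-identityʳ (f (g i))))

ones : (ℕ → Bool) → ℕ → ℕ → ℕ
ones b = sumFrom (⟦_⟧ ∘ b)

Sparse : (ℕ → Bool) → ℕ → Set
Sparse b L = ∀ i → b i ≡ true → (suc i < L → b (suc i) ≡ false) × (2 + i < L → b (2 + i) ≡ false)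

≤-prefix : ∀ a j k {L} → a + (j + k) ≤ L → j + a ≤ L
≤-prefix a j k h = ≤-trans (≤-reflexive (+-comm j a)) (≤-trans (+-monoʳ-≤ a (m≤m+n j k)) h)

mutual
  sparse-count : ∀ {b L} → Sparse b L → ∀ a k → a + k ≤ L → 3 * ones b a k ≤ k + 2
  sparse-count sp a zero _ = z≤n
  sparse-count {b} {L} sp a (suc k) h with b a in ba
  ... | false = ≤-trans (sparse-count sp (suc a) k (subst (_≤ L) (+-suc a k) h)) (n≤1+n _)
  ... | true = begin
    3 * suc (ones b (suc a) k) ≡⟨ *-suc 3 _ ⟩
    3 + 3 * ones b (suc a) k   ≤⟨ +-monoʳ-≤ 3 (after-true sp a k ba h) ⟩
    3 + k                      ≡⟨ cong suc (+-comm 2 k) ⟩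
    suc k + 2                  ∎
    where open ≤-Reasoning

  -- After a true position the next two are false, so the remaining k positions
  -- contribute at most k/3.
  after-true : ∀ {b L} → Sparse b L → ∀ a k → b a ≡ true → a + suc k ≤ L → 3 * ones b (suc a) k ≤ k
  after-true sp a zero _ _ = z≤n
  after-true sp a (suc zero) ba h rewrite proj₁ (sp a ba) (≤-prefix a 2 0 h) = z≤n
  after-true {b} {L} sp a (suc (suc k)) ba h
    rewrite proj₁ (sp a ba) (≤-prefix a 2 (suc k) h) | proj₂ (sp a ba) (≤-prefix a 3 k h) =
    ≤-trans (sparse-count sp (3 + a) k (subst (_≤ L) (x∙yz≈y∙xz a 3 k) h))
            (≤-reflexive (+-comm k 2))

Avoids : (ℕ → Bool) → ℕ → ℕ → Set
Avoids c = AllIn (λ i → c i ≡ false)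

free : (ℕ → Bool) → (ℕ → Bool) → ℕ → ℕ
free b c i = ⟦ not (c i) ∧ not (b i) ⟧

free+ones : ∀ b c a k → Avoids c a k → sumFrom (free b c) a k + ones b a k ≡ k
free+ones b c a zero _ = refl
free+ones b c a (suc k) avoid = begin
  (free b c a + _) + (⟦ b a ⟧ + _) ≡⟨ interchange (free b c a) _ ⟦ b a ⟧ _ ⟩
  (free b c a + ⟦ b a ⟧) + _       ≡⟨ cong₂ _+_ (free-or-b (c a) (b a) (allIn-head avoid))
                                                (free+ones b c (suc a) k (allIn-tail avoid)) ⟩
  suc k                            ∎
  where
  open ≡-Reasoning
  free-or-b : ∀ x y → x ≡ false → ⟦ not x ∧ not y ⟧ + ⟦ y ⟧ ≡ 1
  free-or-b false false _ = refl
  free-or-b false true _ = refl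

segment-bound : ∀ {b L} c → Sparse b L → ∀ a k → a + k ≤ L → Avoids c a k →
  2 * k ≤ 3 * sumFrom (free b c) a k + 2
segment-bound {b} c sp a k h avoid = +-cancelʳ-≤ k (2 * k) (3 * F + 2) (begin
  2 * k + k           ≡⟨ solve 1 (λ k → con 2 :* k :+ k := con 3 :* k) refl k ⟩
  3 * k               ≡⟨ cong (3 *_) (sym (free+ones b c a k avoid)) ⟩
  3 * (F + O)         ≡⟨ *-distribˡ-+ 3 F O ⟩
  3 * F + 3 * O       ≤⟨ +-monoʳ-≤ (3 * F) (sparse-count sp a k h) ⟩
  3 * F + (k + 2)     ≡⟨ solve 2 (λ F k → con 3 :* F :+ (k :+ con 2) := con 3 :* F :+ con 2 :+ k) refl F k ⟩
  3 * F + 2 + k       ∎)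
  where
  open ≤-Reasoning
  open ℕS using (solve; _:+_; _:*_; _:=_; con)
  F = sumFrom (free b c) a k
  O = ones b a k

Clustered : (ℕ → Bool) → ℕ → Set
Clustered c M = ∀ i j → i ≤ j → j ≤ M → c i ≡ true → c j ≡ true → j ≤ 2 + i

first-true : ∀ c L → (∃ λ s → s < L × c s ≡ true × Avoids c 0 s) ⊎ Avoids c 0 L
first-true c zero = inj₂ (λ _ _ ())
first-true c (suc L) with first-true c L
... | inj₁ (s , s<L , cs , before) = inj₁ (s , m≤n⇒m≤1+n s<L , cs , before)
... | inj₂ none with c L in cL
...   | true = inj₁ (L , ≤-refl , cL , none)
...   | false = inj₂ λ i _ i<1+L → [ none i z≤n , (λ { refl → cL }) ] (m≤n⇒m<n∨m≡n (≤-pred i<1+L))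

bound-before : ∀ {b} c M → Sparse b (suc M) → ∀ s → s ≤ suc M → M ≤ suc s → Avoids c 0 s →
  2 * M ≤ 3 * sumFrom (free b c) 0 (suc M) + 8
bound-before {b} c M sp s s≤1+M M≤1+s before with m≤n⇒∃[o]m+o≡n s≤1+M
... | t , s+t≡1+M = begin
  2 * M            ≤⟨ *-monoʳ-≤ 2 M≤1+s ⟩
  2 * suc s        ≡⟨ solve 1 (λ s → con 2 :* (con 1 :+ s) := con 2 :* s :+ con 2) refl s ⟩
  2 * s + 2        ≤⟨ +-monoˡ-≤ 2 (segment-bound c sp 0 s s≤1+M before) ⟩
  3 * S₁ + 2 + 2   ≡⟨ +-assoc (3 * S₁) 2 2 ⟩
  3 * S₁ + 4       ≤⟨ +-mono-≤ (*-monoʳ-≤ 3 S₁≤S) (s≤s (s≤s (s≤s (s≤s z≤n)))) ⟩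
  3 * S + 8        ∎
  where
  open ≤-Reasoning
  open ℕS using (solve; _:+_; _:*_; _:=_; con)
  S₁ = sumFrom (free b c) 0 s
  S = sumFrom (free b c) 0 (suc M)
  S₁≤S : S₁ ≤ S
  S₁≤S = subst (λ k → S₁ ≤ sumFrom (free b c) 0 k) s+t≡1+M (sumFrom-≤-prefix (free b c) 0 s t)

-- Window bound, case 2: [0, M] = [0, s) ∪ [s, s + 3) ∪ [s + 3, s + 3 + r) with c
-- avoided on the two outer stretches.
bound-around : ∀ {b} c M → Sparse b (suc M) → ∀ s r → suc M ≡ s + (3 + r) →
  Avoids c 0 s → Avoids c (s + 3) r → 2 * M ≤ 3 * sumFrom (free b c) 0 (suc M) + 8
bound-around {b} c M sp s r M+1≡ before after = +-cancelʳ-≤ 2 (2 * M) (3 * S + 8) (begin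
  2 * M + 2                      ≡⟨ solve 1 (λ M → con 2 :* M :+ con 2 := con 2 :* (con 1 :+ M)) refl M ⟩
  2 * suc M                      ≡⟨ cong (2 *_) M+1≡ ⟩
  2 * (s + (3 + r))              ≡⟨ solve 2 (λ s r → con 2 :* (s :+ (con 3 :+ r)) := con 2 :* s :+ con 2 :* r :+ con 6) refl s r ⟩
  2 * s + 2 * r + 6              ≤⟨ +-monoˡ-≤ 6 (+-mono-≤ (segment-bound c sp 0 s s≤1+M before)
                                                          (segment-bound c sp (s + 3) r end≤1+M after)) ⟩
  (3 * S₁ + 2) + (3 * S₃ + 2) + 6 ≡⟨ solve 2 (λ a c → (con 3 :* a :+ con 2) :+ (con 3 :* c :+ con 2) :+ con 6
                                                       := con 3 :* (a :+ c) :+ con 10) refl S₁ S₃ ⟩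
  3 * (S₁ + S₃) + 10             ≤⟨ +-monoˡ-≤ 10 (*-monoʳ-≤ 3 (+-monoʳ-≤ S₁ (m≤n+m S₃ S₂))) ⟩
  3 * (S₁ + (S₂ + S₃)) + 10      ≡⟨ cong (λ z → 3 * z + 10) (sym S≡) ⟩
  3 * S + 10                     ≡⟨ +-assoc (3 * S) 8 2 ⟨
  3 * S + 8 + 2                  ∎)
  where
  open ≤-Reasoning
  open ℕS using (solve; _:+_; _:*_; _:=_; con)
  f = free b c
  S₁ = sumFrom f 0 s
  S₂ = sumFrom f s 3
  S₃ = sumFrom f (s + 3) r
  S = sumFrom f 0 (suc M)
  S≡ : S ≡ S₁ + (S₂ + S₃)
  S≡ = trans (cong (sumFrom f 0) M+1≡) (trans (sumFrom-split f 0 s (3 + r)) (cong (S₁ +_) (sumFrom-split f s 3 r)))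
  s≤1+M : s ≤ suc M
  s≤1+M = subst (s ≤_) (sym M+1≡) (m≤m+n s (3 + r))
  end≤1+M : s + 3 + r ≤ suc M
  end≤1+M = ≤-reflexive (trans (+-assoc s 3 r) (sym M+1≡))

window-bound : ∀ {b c M} → Sparse b (suc M) → Clustered c M →
  2 * M ≤ 3 * sumFrom (free b c) 0 (suc M) + 8
window-bound {b} {c} {M} sp cl with first-true c (suc M)
... | inj₂ none = bound-before c M sp (suc M) ≤-refl (m≤n⇒m≤1+n (n≤1+n M)) none
... | inj₁ (s , s<1+M , cs , before) with s + 3 ≤? suc M
...   | no s+3≰1+M = bound-before c M sp s (<⇒≤ s<1+M)
                       (≤-pred (≤-pred (subst (suc (suc M) ≤_) (+-comm s 3) (≰⇒> s+3≰1+M)))) before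
...   | yes s+3≤1+M with m≤n⇒∃[o]m+o≡n s+3≤1+M
...     | r , s+3+r≡1+M = bound-around c M sp s r (trans (sym s+3+r≡1+M) (+-assoc s 3 r)) before after
  where
  after : Avoids c (s + 3) r
  after i s+3≤i i<end with c i in ci
  ... | false = refl
  ... | true = ⊥-elim (<⇒≱ (subst (_≤ i) (+-comm s 3) s+3≤i)
                 (cl s i (≤-trans (m≤m+n s 3) s+3≤i) (≤-pred (subst (i <_) s+3+r≡1+M i<end)) cs ci))

-- The main counting bound.

-- For a geodesic u = v₀, …, v_M = v of H, a packing B and any vertex x:
--   2M + 3(deg x + |B|) ≤ 3n + 8.
-- The vertices split into N[x], the members of B outside N[x] (all of B but at most
-- one) and the remaining "free" vertices.  Along the geodesic N[x] occupies at most
-- three consecutive positions and members of B are at least three apart, so by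
-- window-bound at least (2M − 8)/3 geodesic vertices are free.
module GeodesicPacking {n} (H : Graph n) {u v M} (geo : Dist H u v M) {B} (P : IsPacking H B) (x : Fin n) where
  open Geodesic {G = H} geo

  inB near free-vertex : Fin n → Bool
  inB = lookup B
  near w = does (inN? H x w)
  free-vertex w = not (near w) ∧ not (inB w)

  apart : ∀ i j → i < j → j ≤ M → ∀ w → InN H v[ i ] w → InN H v[ j ] w →
    inB v[ i ] ≡ true → inB v[ j ] ≡ false
  apart i j i<j j≤M w iw jw Bi with inB v[ j ] in Bj
  ... | false = refl
  ... | true = ⊥-elim (P v[ i ] v[ j ] (lookup⇒[]= _ B Bi) (lookup⇒[]= _ B Bj) (injective i<j j≤M) w (iw , jw))

  -- Members of B on the geodesic are at least three positions apart: positions i and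
  -- i + 1 or i + 2 share the closed neighbourhood point v_{i+1}.
  sparse : Sparse (inB ∘ v[_]) (suc M)
  sparse i Bi = (λ i+1<1+M → apart i (suc i) ≤-refl (≤-pred i+1<1+M) v[ suc i ]
                                (inj₂ (consecutive i (≤-pred i+1<1+M))) (inj₁ refl) Bi)
              , (λ i+2<1+M → apart i (2 + i) (n≤1+n (suc i)) (≤-pred i+2<1+M) v[ suc i ]
                                (inj₂ (consecutive i (≤-trans (n≤1+n (suc i)) (≤-pred i+2<1+M))))
                                (InN-sym {G = H} (inj₂ (consecutive (suc i) (≤-pred i+2<1+M)))) Bi)

  clustered : Clustered (near ∘ v[_]) M
  clustered i j i≤j j≤M xi xj = nbhd-window (holds (inN? H x _) xi) (holds (inN? H x _) xj) i≤j j≤M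

  free-on-geodesic : 2 * M ≤ 3 * count free-vertex + 8
  free-on-geodesic = ≤-trans (window-bound sparse clustered)
    (+-monoˡ-≤ 8 (*-monoʳ-≤ 3 (injective-sum v[_] (suc M)
      (λ i j i<j j<1+M → injective i<j (≤-pred j<1+M)) free-vertex)))

  ∣N[x]∣ : count near ≡ suc (deg H x)
  ∣N[x]∣ = begin
    count near                                   ≡⟨ count-remove near x ⟩
    ⟦ near x ⟧ + count (λ w → near w ∧ not (w == x)) ≡⟨ cong₂ (λ b m → ⟦ b ⟧ + m) (dec-true (inN? H x x) (inj₁ refl))
                                                               (count-cong punctured) ⟩
    suc (count (adj H x))                        ≡⟨ cong suc (deg≡count H x) ⟨
    suc (deg H x)                                ∎
    where
    open ≡-Reasoning
    punctured : ∀ w → near w ∧ not (w == x) ≡ adj H x w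
    punctured w with w ≟ x
    ... | yes refl rewrite adj-irrefl H w = refl
    ... | no _ with adj H x w
    ...   | true = refl
    ...   | false = refl

  ∣B∣ : ∣ B ∣ ≤ 1 + count (λ w → not (near w) ∧ inB w)
  ∣B∣ = begin
    ∣ B ∣                                                        ≡⟨ ∣∣≡count B ⟩
    count inB                                                    ≡⟨ count-split inB near ⟩
    count (λ w → inB w ∧ near w) + count (λ w → inB w ∧ not (near w))
      ≤⟨ +-mono-≤ (near-≤1 H P x _ near-member) (≤-reflexive (count-cong (λ w → ∧-comm (inB w) _))) ⟩
    1 + count (λ w → not (near w) ∧ inB w)                       ∎
    where
    open ≤-Reasoning
    near-member : ∀ b → inB b ∧ near b ≡ true → b ∈ B × InN H b x
    near-member b e = lookup⇒[]= b B (proj₁ (∧-true e)) , InN-sym {G = H} (holds (inN? H x b) (proj₂ (∧-true e)))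

  partition : n ≡ count near + (count (λ w → not (near w) ∧ inB w) + count free-vertex)
  partition = trans (sym (count-all n))
    (trans (count-split (λ _ → true) near) (cong (count near +_) (count-split (not ∘ near) inB)))

  inequality : 2 * M + 3 * (deg H x + ∣ B ∣) ≤ 3 * n + 8
  inequality = begin
    2 * M + 3 * (d + ∣ B ∣)            ≤⟨ +-mono-≤ free-on-geodesic (*-monoʳ-≤ 3 (+-monoʳ-≤ d ∣B∣)) ⟩
    3 * c + 8 + 3 * (d + (1 + b))      ≡⟨ solve 3 (λ c d b → con 3 :* c :+ con 8 :+ con 3 :* (d :+ (con 1 :+ b))
                                                     := con 3 :* ((con 1 :+ d) :+ (b :+ c)) :+ con 8) refl c d b ⟩
    3 * (suc d + (b + c)) + 8          ≡⟨ cong (λ z → 3 * (z + (b + c)) + 8) ∣N[x]∣ ⟨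
    3 * (count near + (b + c)) + 8     ≡⟨ cong (λ z → 3 * z + 8) partition ⟨
    3 * n + 8                          ∎
    where
    open ≤-Reasoning
    open ℕS using (solve; _:+_; _:*_; _:=_; con)
    d = deg H x
    b = count (λ w → not (near w) ∧ inB w)
    c = count free-vertex

distance-packing-bound : ∀ {n} (H : Graph n) {u v M r} → Dist H u v M → IsPackingNumber H r →
  2 * M + 3 * (maxDeg H + r) ≤ 3 * n + 8
distance-packing-bound {n} H {u} {M = M} {r} geo ((B , P , refl) , _) with maxDeg-attained H
... | inj₂ (x , Δ≡deg) = subst (λ Δ → 2 * M + 3 * (Δ + ∣ B ∣) ≤ 3 * n + 8) (sym Δ≡deg)
                           (GeodesicPacking.inequality H geo P x)
... | inj₁ Δ≡0 = ≤-trans (+-monoʳ-≤ (2 * M) (*-monoʳ-≤ 3 (+-monoˡ-≤ ∣ B ∣ {maxDeg H} {deg H u}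
                                                    (≤-trans (≤-reflexive Δ≡0) z≤n))))
                   (GeodesicPacking.inequality H geo P u)

ceil3-≤ : ∀ z y → z ℤ.≤ y ℤ.* ℤ.+ 3 → ceil3 z ℤ.≤ y
ceil3-≤ z y z≤3y = subst (ceil3 z ℤ.≤_) (ℤP.neg-involutive y) (ℤP.neg-mono-≤ -y≤⌊-z/3⌋)
  where
  -y*3≤-z : ℤ.- y ℤ.* ℤ.+ 3 ℤ.≤ ℤ.- z
  -y*3≤-z = subst (ℤ._≤ ℤ.- z) (ℤP.neg-distribˡ-* y (ℤ.+ 3)) (ℤP.neg-mono-≤ z≤3y)
  -y≤⌊-z/3⌋ : ℤ.- y ℤ.≤ (ℤ.- z) ℤ./ℕ 3
  -y≤⌊-z/3⌋ with ℤ.- y ℤ.≤? (ℤ.- z) ℤ./ℕ 3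
  ... | yes ok = ok
  ... | no too-big = ⊥-elim (ℤP.<-irrefl refl (ℤP.<-≤-trans
          (ℤP.≤-<-trans -y*3≤-z (n<s[n/ℕd]*d (ℤ.- z) 3))
          (ℤP.*-monoʳ-≤-nonNeg (ℤ.+ 3) (ℤP.i<j⇒suc[i]≤j (ℤP.≰⇒> too-big)))))

-- s ≤ n − ⌈(A − c)/3⌉ as soon as A + 3s ≤ 3n + c: the bounds of the theorem are
-- integer forms of linear inequalities over ℕ.
≤-n-ceil3 : ∀ n A c s → A + 3 * s ≤ 3 * n + c → ℤ.+ s ℤ.≤ ℤ.+ n ℤ.- ceil3 (ℤ.+ A ℤ.- ℤ.+ c)
≤-n-ceil3 n A c s h = subst (ℤ._≤ ℤ.+ n ℤ.- ceil3 (X ℤ.- C))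
  (solve 2 (λ N S → N :- (N :- S) := S) refl N S)
  (ℤP.+-monoʳ-≤ N (ℤP.neg-mono-≤ (ceil3-≤ (X ℤ.- C) (N ℤ.- S) A-c≤[n-s]*3)))
  where
  open ℤS using (solve; _:+_; _:*_; _:-_; _:=_; con)
  X = ℤ.+ A
  C = ℤ.+ c
  N = ℤ.+ n
  S = ℤ.+ s
  h-in-ℤ : X ℤ.+ ℤ.+ 3 ℤ.* S ℤ.≤ ℤ.+ 3 ℤ.* N ℤ.+ C
  h-in-ℤ = subst₂ ℤ._≤_ (trans (ℤP.pos-+ A (3 * s)) (cong (λ z → X ℤ.+ z) (ℤP.pos-* 3 s)))
                        (trans (ℤP.pos-+ (3 * n) c) (cong (λ z → z ℤ.+ C) (ℤP.pos-* 3 n))) (ℤ.+≤+ h)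
  A-c≤[n-s]*3 : X ℤ.- C ℤ.≤ (N ℤ.- S) ℤ.* ℤ.+ 3
  A-c≤[n-s]*3 = subst₂ ℤ._≤_
    (solve 3 (λ X S C → (X :+ con (ℤ.+ 3) :* S) :- (C :+ con (ℤ.+ 3) :* S) := X :- C) refl X S C)
    (solve 3 (λ N S C → (con (ℤ.+ 3) :* N :+ C) :- (C :+ con (ℤ.+ 3) :* S) := (N :- S) :* con (ℤ.+ 3)) refl N S C)
    (ℤP.+-monoˡ-≤ (ℤ.- (C ℤ.+ ℤ.+ 3 ℤ.* S)) h-in-ℤ)

-- If H has the larger diameter M, then ρ(K) ≤ 1: distance ≥ 4 in H puts all pairs
-- within distance 2 in K, and if M ≤ 3 then diam K < M gives diam K ≤ 2 directly.
smaller-diameter-packing≤1 : ∀ {n} {H K : Graph n} {M d r} → Covers H K → IsDiam H M → IsDiam K d →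
  d < M → IsPackingNumber K r → r ≤ 1
smaller-diameter-packing≤1 {K = K} {M} cov (_ , _ , _ , geo) diamK d<M ((B , P , refl) , _) =
  AllCommon⇒packing≤1 K all-common P
  where
  all-common : AllCommon K
  all-common with 4 ≤? M
  ... | yes 4≤M = far⇒AllCommon cov (λ k k≤3 → proj₂ geo k (≤-trans (s≤s k≤3) 4≤M))
  ... | no 4≰M = diam≤2⇒AllCommon diamK (≤-pred (≤-trans d<M (≤-pred (≰⇒> 4≰M))))

larger-diameter-bounds : ∀ {n} {H K : Graph n} {M d r r′ Δ′} → Covers H K →
  IsDiam H M → IsDiam K d → d < M → IsPackingNumber H r → IsPackingNumber K r′ → Δ′ ≤ maxDeg H →
  (ℤ.+ (r + r′) ℤ.≤ bound n M Δ′ 11) × (ℤ.+ (r * r′) ℤ.≤ bound n M Δ′ 8)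
larger-diameter-bounds {n} {H} {M = M} {r = r} {r′} {Δ′} cov diamH diamK d<M ρH ρK Δ′≤Δ =
  ℤP.≤-trans (ℤ.+≤+ (+-monoʳ-≤ r r′≤1)) (≤-n-ceil3 n (2 * M + 3 * Δ′) 11 (r + 1) sum-form) ,
  ℤP.≤-trans (ℤ.+≤+ (≤-trans (*-monoʳ-≤ r r′≤1) (≤-reflexive (*-identityʳ r)))) (≤-n-ceil3 n (2 * M + 3 * Δ′) 8 r key)
  where
  open ≤-Reasoning
  open ℕS using (solve; _:+_; _:*_; _:=_; con)
  r′≤1 : r′ ≤ 1
  r′≤1 = smaller-diameter-packing≤1 cov diamH diamK d<M ρK
  key : 2 * M + 3 * Δ′ + 3 * r ≤ 3 * n + 8
  key = begin
    2 * M + 3 * Δ′ + 3 * r    ≡⟨ solve 3 (λ M Δ r → con 2 :* M :+ con 3 :* Δ :+ con 3 :* r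
                                                     := con 2 :* M :+ con 3 :* (Δ :+ r)) refl M Δ′ r ⟩
    2 * M + 3 * (Δ′ + r)      ≤⟨ +-monoʳ-≤ (2 * M) (*-monoʳ-≤ 3 (+-monoˡ-≤ r Δ′≤Δ)) ⟩
    2 * M + 3 * (maxDeg H + r) ≤⟨ distance-packing-bound H (proj₂ (proj₂ (proj₂ diamH))) ρH ⟩
    3 * n + 8                 ∎
  sum-form : 2 * M + 3 * Δ′ + 3 * (r + 1) ≤ 3 * n + 11
  sum-form = begin
    2 * M + 3 * Δ′ + 3 * (r + 1) ≡⟨ solve 3 (λ M Δ r → con 2 :* M :+ con 3 :* Δ :+ con 3 :* (r :+ con 1)
                                                  := con 2 :* M :+ con 3 :* Δ :+ con 3 :* r :+ con 3) refl M Δ′ r ⟩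
    2 * M + 3 * Δ′ + 3 * r + 3   ≤⟨ +-monoˡ-≤ 3 key ⟩
    3 * n + 8 + 3                ≡⟨ +-assoc (3 * n) 8 3 ⟩
    3 * n + 11                   ∎

part-i : ∀ {n} {G : Graph n} {dG dGc r rc} → Hyp n G dG dGc r rc →
  dG ≡ 3 → dGc ≡ 3 → (r + rc ≡ 4) × (r * rc ≡ 4)
part-i {G = G} {r = r} {rc} (_ , _ , diamG , diamGc , ρG , ρGc , _) refl refl =
  cong₂ _+_ ρ≡ ρc≡ , cong₂ _*_ ρ≡ ρc≡
  where
  ρ≡ : r ≡ 2
  ρ≡ = ρ≡2 (complement-covers G) diamG diamGc ρG
  ρc≡ : rc ≡ 2
  ρc≡ = ρ≡2 (complement-covered G) diamGc diamG ρGc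

part-ii : ∀ {n} {G : Graph n} {dG dGc r rc} → Hyp n G dG dGc r rc → dG ≢ dGc →
  (ℤ.+ (r + rc) ℤ.≤ bound n (dG ⊔ dGc) (maxDeg G ⊓ maxDeg (complement G)) 11)
  × (ℤ.+ (r * rc) ℤ.≤ bound n (dG ⊔ dGc) (maxDeg G ⊓ maxDeg (complement G)) 8)
part-ii {n} {G} {dG} {dGc} {r} {rc} (_ , _ , diamG , diamGc , ρG , ρGc , _) dG≢dGc with <-cmp dG dGc
... | tri≈ _ dG≡dGc _ = ⊥-elim (dG≢dGc dG≡dGc)
... | tri> _ _ dGc<dG rewrite m≥n⇒m⊔n≡m (<⇒≤ dGc<dG) =
  larger-diameter-bounds (complement-covers G) diamG diamGc dGc<dG ρG ρGc (m⊓n≤m (maxDeg G) (maxDeg (complement G)))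
... | tri< dG<dGc _ _ rewrite m≤n⇒m⊔n≡n (<⇒≤ dG<dGc) | +-comm r rc | *-comm r rc =
  larger-diameter-bounds (complement-covered G) diamGc diamG dG<dGc ρGc ρG (m⊓n≤n (maxDeg G) (maxDeg (complement G)))

-- Sharpness.

module Decide {n} (G : Graph n) where

  walk? : ∀ k u v → Dec (Walk G u v k)
  walk? zero u v = map′ (λ { refl → here }) (λ { here → refl }) (u ≟ v)
  walk? (suc k) u v = map′ (λ (w , e , p) → step e p) (λ { (step e p) → _ , e , p })
    (any? λ w → (adj G u w Bool.≟ true) ×-dec walk? k w v)

  dist? : ∀ u v d → Dec (Dist G u v d)
  dist? u v d = walk? d u v ×-dec
    map′ (λ shorter k k<d → shorter {k} k<d) (λ shorter {k} k<d → shorter k k<d) (allUpTo? (λ k → ¬? (walk? k u v)) d)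

  within? : ∀ d → Dec (∀ u v → ∃ λ k → Dist G u v k × k ≤ d)
  within? d = all? λ u → all? λ v →
    map′ (λ (k , k<1+d , D) → k , D , ≤-pred k<1+d) (λ (k , D , k≤d) → k , s≤s k≤d , D)
         (anyUpTo? (dist? u v) (suc d))

  packing? : ∀ B → Dec (IsPacking G B)
  packing? B = all? λ a → all? λ b → (a ∈? B) →-dec (b ∈? B) →-dec ¬? (a ≟ b) →-dec
    all? λ w → ¬? (inN? G a w ×-dec inN? G b w)

-- The spider with edges 0–1, 0–2, 0–5, 1–4, 2–3: diam G = 4, diam Ḡ = 2, Δ(G) = 3,
-- Δ(Ḡ) = 4, ρ(G) = 3 (the leaves) and ρ(Ḡ) = 1, so ρ + ρ̄ = 4 = 6 − ⌈(8 + 9 − 11)/3⌉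
-- and ρρ̄ = 3 = 6 − ⌈(8 + 9 − 8)/3⌉.
edge : ℕ → ℕ → Bool
edge 0 1 = true
edge 0 2 = true
edge 0 5 = true
edge 1 4 = true
edge 2 3 = true
edge _ _ = false

spider : Graph 6
spider = record
  { adj = adjacent
  ; adj-sym = λ i j → ∨-comm (edge (toℕ i) (toℕ j)) _
  ; adj-irrefl = from-yes (all? λ i → adjacent i i Bool.≟ false)
  }
  where
  adjacent : Fin 6 → Fin 6 → Bool
  adjacent i j = edge (toℕ i) (toℕ j) ∨ edge (toℕ j) (toℕ i)

spider-diam : IsDiam spider 4
spider-diam = from-yes (Decide.within? spider 4) , # 4 , # 3 , from-yes (Decide.dist? spider (# 4) (# 3) 4)

spider-co-diam : IsDiam (complement spider) 2
spider-co-diam = from-yes (Decide.within? (complement spider) 2) ,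
  # 0 , # 1 , from-yes (Decide.dist? (complement spider) (# 0) (# 1) 2)

-- The three leaves form a maximum packing: the main counting bound at the centre
-- (degree 3) caps any packing at 3.
spider-ρ : IsPackingNumber spider 3
spider-ρ = (leaves , from-yes (Decide.packing? spider leaves) , refl) , at-most-3
  where
  leaves : Subset 6
  leaves = false ∷ false ∷ false ∷ true ∷ true ∷ true ∷ []
  at-most-3 : ∀ B → IsPacking spider B → ∣ B ∣ ≤ 3
  at-most-3 B P = +-cancelˡ-≤ 3 ∣ B ∣ 3 (*-cancelˡ-≤ 3 (+-cancelˡ-≤ 8 (3 * (3 + ∣ B ∣)) 18
    (GeodesicPacking.inequality spider (proj₂ (proj₂ (proj₂ spider-diam))) P (# 0))))

spider-co-ρ : IsPackingNumber (complement spider) 1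
spider-co-ρ = (⁅ # 0 ⁆ , from-yes (Decide.packing? (complement spider) ⁅ # 0 ⁆) , refl) ,
  λ B → AllCommon⇒packing≤1 (complement spider) (diam≤2⇒AllCommon spider-co-diam ≤-refl)

spider-hyp : Hyp 6 spider 4 2 3 1
spider-hyp = connected spider-diam , connected spider-co-diam , spider-diam , spider-co-diam ,
             spider-ρ , spider-co-ρ , s≤s (s≤s (s≤s z≤n))
  where
  connected : ∀ {n} {H : Graph n} {d} → IsDiam H d → Connected H
  connected (reach , _) u v with reach u v
  ... | k , (p , _) , _ = k , p

mainTheorem3 :
    ((n : ℕ) (G : Graph n) (dG dGc r rc : ℕ) → Hyp n G dG dGc r rc →
      ((dG ≡ 3 → dGc ≡ 3 → (r + rc ≡ 4) × (r * rc ≡ 4))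
      × (dG ≢ dGc →
          (ℤ.+ (r + rc) ℤ.≤ bound n (dG ⊔ dGc) (maxDeg G ⊓ maxDeg (complement G)) 11)
          × (ℤ.+ (r * rc) ℤ.≤ bound n (dG ⊔ dGc) (maxDeg G ⊓ maxDeg (complement G)) 8))))
    × (∃ λ n → ∃ λ (G : Graph n) → ∃ λ dG → ∃ λ dGc → ∃ λ r → ∃ λ rc →
        Hyp n G dG dGc r rc × dG ≢ dGc
        × (ℤ.+ (r + rc) ≡ bound n (dG ⊔ dGc) (maxDeg G ⊓ maxDeg (complement G)) 11))
    × (∃ λ n → ∃ λ (G : Graph n) → ∃ λ dG → ∃ λ dGc → ∃ λ r → ∃ λ rc →
        Hyp n G dG dGc r rc × dG ≢ dGc
        × (ℤ.+ (r * rc) ≡ bound n (dG ⊔ dGc) (maxDeg G ⊓ maxDeg (complement G)) 8))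
mainTheorem3 =
  (λ n G dG dGc r rc hyp → part-i hyp , part-ii hyp) ,
  (6 , spider , 4 , 2 , 3 , 1 , spider-hyp , (λ ()) , refl) ,
  (6 , spider , 4 , 2 , 3 , 1 , spider-hyp , (λ ()) , refl)
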